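{- For any untyped $\lambda$-term $M$, the following are equivalent: (1) $M$ is typable in $\Lambda_{\cap}$, i.e. $\Gamma\vdash M:A$ for some typing context $\Gamma$ and type $A$; (2) $M$ is typable in $\Lambda_{\cap}^{s}$, i.e. $\Gamma\vdash_s M:A$ for some $\Gamma$, $A$; (3) $M$ is strongly $\beta$-normalising; (4) $M$ is typable in $\Lambda_{\cap}^{s}$ by a derivation that does not use the rule $(\mathsf{R}\cap)$.
   Context: $\lambda$-terms: $M::=x\mid MM\mid \lambda x.M$, modulo $\alpha$-conversion; $M[x:=N]$ is capture-avoiding substitution; $\to_\beta$ is the contextual closure of $(\lambda x.M)N\to M[x:=N]$; $M$ is strongly normalising if every $\beta$-reduction sequence from $M$ is finite. Types: $A::=\varphi\mid A\to A\mid A\cap A$, $\varphi$ ranging over type variables. A typing context is a finite set of pairs $x:A$; $\Gamma,x:A$ denotes $\Gamma\cup\{x:A\}$; $x\notin\Gamma$ means $x:B\notin\Gamma$ for every $B$. In $\Lambda_\cap$ the variables of a context are pairwise distinct; in $\Lambda_\cap^s$ a variable may occur with several types. System $\Lambda_\cap$ (judgements $\Gamma\vdash M:A$): (Ax) $\Gamma,x:A\vdash x:A$; ($\to$I) from $\Gamma,x:A\vdash M:B$ with $x\notin\Gamma$ infer $\Gamma\vdash\lambda x.M:A\to B$; ($\to$E) from $\Gamma\vdash M:A\to B$ and $\Gamma\vdash N:A$ infer $\Gamma\vdash MN:B$; ($\cap$I) from $\Gamma\vdash M:A$ and $\Gamma\vdash M:B$ infer $\Gamma\vdash M:A\cap B$;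 ($\cap$E) from $\Gamma\vdash M:A\cap B$ infer $\Gamma\vdash M:A$ and $\Gamma\vdash M:B$. System $\Lambda_\cap^s$ (judgements $\Gamma\vdash_s M:A$; below $n\ge0$): (Ax) $\Gamma,x:A\vdash_s x:A$; $(\mathsf{Beta})^s$ from $\Gamma\vdash_s M[x:=N]N_1\dots N_n:A$ and $\Gamma\vdash_s N:B$ infer $\Gamma\vdash_s(\lambda x.M)NN_1\dots N_n:A$; $(\mathsf{L}\to)$ from $\Gamma\vdash_s N:A_1$ and $\Gamma,y:A_2\vdash_s yN_1\dots N_n:B$, where $y\notin FV(N_1)\cup\dots\cup FV(N_n)$ and $y\notin\Gamma$, infer $\Gamma,x:A_1\to A_2\vdash_s xNN_1\dots N_n:B$; $(\mathsf{R}\to)$ from $\Gamma,x:A\vdash_s M:B$ with $x\notin\Gamma$ infer $\Gamma\vdash_s\lambda x.M:A\to B$; $(\mathsf{L}\cap)$ from $\Gamma,x:A_1,x:A_2\vdash_s xN_1\dots N_n:B$ infer $\Gamma,x:A_1\cap A_2\vdash_s xN_1\dots N_n:B$; $(\mathsf{R}\cap)$ from $\Gamma\vdash_s M:A$ and $\Gamma\vdash_s M:B$ infer $\Gamma\vdash_s M:A\cap B$. -}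

module Defs where

open import Data.Nat using (ℕ; zero; suc)
open import Data.Bool using (Bool; true; false)
open import Data.Unit using (⊤)
open import Data.List using (List; []; _∷_; map)
open import Data.Product using (_×_; _,_; Σ; ∃; ∃-syntax)
open import Data.List.Membership.Propositional using (_∈_)
open import Relation.Nullary using (¬_)
open import Relation.Binary.PropositionalEquality using (_≡_)
open import Induction.WellFounded using (Acc)

-- λ-terms modulo α-conversion: de Bruijn indices.
-- Free variables are the indices that escape all binders.

data Tm : Set where
  var : ℕ → Tm
  app : Tm → Tm → Tm
  lam : Tm → Tm

ext : (ℕ → ℕ) → ℕ → ℕ
ext ρ zero    = zero
ext ρ (suc n) = suc (ρ n)

rename : (ℕ → ℕ) → Tm → Tm
rename ρ (var x)   = var (ρ x)
rename ρ (app M N) = app (rename ρ M) (rename ρ N)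
rename ρ (lam M)   = lam (rename (ext ρ) M)

exts : (ℕ → Tm) → ℕ → Tm
exts σ zero    = var zero
exts σ (suc n) = rename suc (σ n)

subst : (ℕ → Tm) → Tm → Tm
subst σ (var x)   = σ x
subst σ (app M N) = app (subst σ M) (subst σ N)
subst σ (lam M)   = lam (subst (exts σ) M)

σ₀ : Tm → ℕ → Tm
σ₀ N zero    = N
σ₀ N (suc n) = var n

-- M [ N ] : substitute N for the variable bound by the λ whose body is M
_[_] : Tm → Tm → Tm
M [ N ] = subst (σ₀ N) M

apps : Tm → List Tm → Tm
apps M []       = M
apps M (N ∷ Ns) = apps (app M N) Ns

data _∈FV_ : ℕ → Tm → Set where
  fv-var : ∀ {x} → x ∈FV var x
  fv-appˡ : ∀ {x M N} → x ∈FV M → x ∈FV app M N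
  fv-appʳ : ∀ {x M N} → x ∈FV N → x ∈FV app M N
  fv-lam : ∀ {x M} → suc x ∈FV M → x ∈FV lam M

_∉FVs_ : ℕ → List Tm → Set
y ∉FVs []       = ⊤
y ∉FVs (N ∷ Ns) = (¬ y ∈FV N) × (y ∉FVs Ns)

infix 4 _→β_
data _→β_ : Tm → Tm → Set where
  β    : ∀ {M N} → app (lam M) N →β M [ N ]
  appˡ : ∀ {M M' N} → M →β M' → app M N →β app M' N
  appʳ : ∀ {M N N'} → N →β N' → app M N →β app M N'
  ξ    : ∀ {M M'} → M →β M' → lam M →β lam M'

SN : Tm → Set
SN = Acc (λ N M → M →β N)

infixr 7 _⇒_
infixl 8 _∩_
data Ty : Set where
  tv  : ℕ → Ty
  _⇒_ : Ty → Ty → Ty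
  _∩_ : Ty → Ty → Ty

-- typing contexts: finite sets of pairs x : A, represented by lists
-- and compared as sets.

Ctx : Set
Ctx = List (ℕ × Ty)

_≈_ : Ctx → Ctx → Set
Γ ≈ Δ = ∀ p → (p ∈ Γ → p ∈ Δ) × (p ∈ Δ → p ∈ Γ)

_∉_ : ℕ → Ctx → Set
x ∉ Γ = ∀ B → ¬ ((x , B) ∈ Γ)

Distinct : Ctx → Set
Distinct Γ = ∀ x A B → (x , A) ∈ Γ → (x , B) ∈ Γ → A ≡ B

shiftCtx : Ctx → Ctx
shiftCtx = map (λ { (x , A) → (suc x , A) })

-- "Γ, x:A" where x is the variable bound by the λ (index 0)
-- is  (zero , A) ∷ shiftCtx Γ ; the side condition x ∉ Γ holds by construction.

infix 3 _⊢_∶_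
data _⊢_∶_ : Ctx → Tm → Ty → Set where
  Ax  : ∀ {Δ Γ x A} → Δ ≈ ((x , A) ∷ Γ) → Δ ⊢ var x ∶ A
  ⇒I  : ∀ {Γ M A B} → ((zero , A) ∷ shiftCtx Γ) ⊢ M ∶ B → Γ ⊢ lam M ∶ A ⇒ B
  ⇒E  : ∀ {Γ M N A B} → Γ ⊢ M ∶ A ⇒ B → Γ ⊢ N ∶ A → Γ ⊢ app M N ∶ B
  ∩I  : ∀ {Γ M A B} → Γ ⊢ M ∶ A → Γ ⊢ M ∶ B → Γ ⊢ M ∶ A ∩ B
  ∩Eˡ : ∀ {Γ M A B} → Γ ⊢ M ∶ A ∩ B → Γ ⊢ M ∶ A
  ∩Eʳ : ∀ {Γ M A B} → Γ ⊢ M ∶ A ∩ B → Γ ⊢ M ∶ B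

-- System Λ∩ˢ, indexed by a flag saying whether (R∩) may be used.

infix 3 _⊢s⟨_⟩_∶_
data _⊢s⟨_⟩_∶_ : Ctx → Bool → Tm → Ty → Set where
  Ax   : ∀ {r Δ Γ x A} → Δ ≈ ((x , A) ∷ Γ) → Δ ⊢s⟨ r ⟩ var x ∶ A
  Beta : ∀ {r Γ M N Ns A B} →
         Γ ⊢s⟨ r ⟩ apps (M [ N ]) Ns ∶ A → Γ ⊢s⟨ r ⟩ N ∶ B →
         Γ ⊢s⟨ r ⟩ apps (app (lam M) N) Ns ∶ A
  L⇒   : ∀ {r Δ Γ x y N Ns A₁ A₂ B} →
         y ∉FVs Ns → y ∉ Γ →
         Γ ⊢s⟨ r ⟩ N ∶ A₁ → ((y , A₂) ∷ Γ) ⊢s⟨ r ⟩ apps (var y) Ns ∶ B →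
         Δ ≈ ((x , A₁ ⇒ A₂) ∷ Γ) →
         Δ ⊢s⟨ r ⟩ apps (var x) (N ∷ Ns) ∶ B
  R⇒   : ∀ {r Γ M A B} → ((zero , A) ∷ shiftCtx Γ) ⊢s⟨ r ⟩ M ∶ B →
         Γ ⊢s⟨ r ⟩ lam M ∶ A ⇒ B
  L∩   : ∀ {r Δ Γ x Ns A₁ A₂ B} →
         ((x , A₁) ∷ (x , A₂) ∷ Γ) ⊢s⟨ r ⟩ apps (var x) Ns ∶ B →
         Δ ≈ ((x , A₁ ∩ A₂) ∷ Γ) →
         Δ ⊢s⟨ r ⟩ apps (var x) Ns ∶ B
  R∩   : ∀ {Γ M A B} → Γ ⊢s⟨ true ⟩ M ∶ A → Γ ⊢s⟨ true ⟩ M ∶ B →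
         Γ ⊢s⟨ true ⟩ M ∶ A ∩ B

Typable∩ : Tm → Set
Typable∩ M = ∃[ Γ ] ∃[ A ] (Distinct Γ × (Γ ⊢ M ∶ A))

Typableˢ : Tm → Set
Typableˢ M = ∃[ Γ ] ∃[ A ] (Γ ⊢s⟨ true ⟩ M ∶ A)

Typableˢ-noR∩ : Tm → Set
Typableˢ-noR∩ M = ∃[ Γ ] ∃[ A ] (Γ ⊢s⟨ false ⟩ M ∶ A)

-- Typable terms are strongly normalising: for Λ∩ by Tait's reducibility method, and for
-- Λ∩ˢ directly, since each rule preserves strong normalisation ((Beta) because SN is closed
-- under head expansion with a strongly normalising argument). Conversely, the strongly
-- normalising terms are generated by spines x N₁…Nₙ, abstractions and head redexes
-- (λx.M) N N₁…Nₙ with SN contractum and SN argument. Induction on this characterisation gives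
-- a Λ∩ˢ derivation without (R∩), intersections assumed for a variable being split by (L∩),
-- and a Λ∩ derivation, whose redex case is subject expansion: the types N receives at the
-- occurrences of x in M[x:=N] are intersected into one type for x.

module Submission where

open import Defs
open import Data.Bool using (true; false)
open import Data.Empty using (⊥; ⊥-elim)
open import Data.List using (List; []; _∷_; _++_)
open import Data.List.Membership.Propositional using (_∈_)
open import Data.List.Membership.Propositional.Properties using (∈-map⁻; ∈-map⁺; ∈-++⁺ˡ; ∈-++⁺ʳ)
open import Data.List.Relation.Binary.Subset.Propositional using (_⊆_)
open import Data.List.Relation.Unary.All using (All; []; _∷_)
open import Data.List.Relation.Unary.All.Properties using (++⁺)
open import Data.List.Relation.Unary.Any using (here; there)
open import Data.Maybe using (Maybe; just; nothing)
open import Data.Nat using (ℕ; zero; suc; _⊔_; _<_; _≤_; pred)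
open import Data.Nat.Properties using (m≤m⊔n; m≤n⊔m; <-≤-trans; ≤-trans; ≤-refl; <-irrefl; pred-mono-≤)
open import Data.Product using (_×_; _,_; ∃-syntax; proj₁; proj₂)
open import Data.Unit using (⊤; tt)
open import Function using (_∘_)
open import Function.Bundles using (_⇔_; mk⇔)
open import Induction.WellFounded using (acc; acc-inverse)
open import Relation.Binary.Construct.Closure.ReflexiveTransitive using (Star; ε; _◅_; _◅◅_; gmap)
open import Relation.Binary.PropositionalEquality
  using (_≡_; refl; sym; trans; cong; cong₂; _≗_) renaming (subst to transport)
open import Relation.Nullary using (¬_)

-- Renaming and substitution

ext-cong : ∀ {ρ ρ′} → ρ ≗ ρ′ → ext ρ ≗ ext ρ′
ext-cong e zero    = refl
ext-cong e (suc x) = cong suc (e x)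

rename-cong : ∀ {ρ ρ′} → ρ ≗ ρ′ → ∀ M → rename ρ M ≡ rename ρ′ M
rename-cong e (var x)   = cong var (e x)
rename-cong e (app M N) = cong₂ app (rename-cong e M) (rename-cong e N)
rename-cong e (lam M)   = cong lam (rename-cong (ext-cong e) M)

exts-cong : ∀ {σ τ} → σ ≗ τ → exts σ ≗ exts τ
exts-cong e zero    = refl
exts-cong e (suc x) = cong (rename suc) (e x)

subst-cong : ∀ {σ τ} → σ ≗ τ → ∀ M → subst σ M ≡ subst τ M
subst-cong e (var x)   = e x
subst-cong e (app M N) = cong₂ app (subst-cong e M) (subst-cong e N)
subst-cong e (lam M)   = cong lam (subst-cong (exts-cong e) M)

rename-rename : ∀ ρ ρ′ M → rename ρ (rename ρ′ M) ≡ rename (ρ ∘ ρ′) M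
rename-rename ρ ρ′ (var x)   = refl
rename-rename ρ ρ′ (app M N) = cong₂ app (rename-rename ρ ρ′ M) (rename-rename ρ ρ′ N)
rename-rename ρ ρ′ (lam M)   = cong lam (trans (rename-rename (ext ρ) (ext ρ′) M)
  (rename-cong (λ { zero → refl ; (suc x) → refl }) M))

subst-rename : ∀ σ ρ M → subst σ (rename ρ M) ≡ subst (σ ∘ ρ) M
subst-rename σ ρ (var x)   = refl
subst-rename σ ρ (app M N) = cong₂ app (subst-rename σ ρ M) (subst-rename σ ρ N)
subst-rename σ ρ (lam M)   = cong lam (trans (subst-rename (exts σ) (ext ρ) M)
  (subst-cong (λ { zero → refl ; (suc x) → refl }) M))

rename-subst : ∀ ρ σ M → rename ρ (subst σ M) ≡ subst (rename ρ ∘ σ) M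
rename-subst ρ σ (var x)   = refl
rename-subst ρ σ (app M N) = cong₂ app (rename-subst ρ σ M) (rename-subst ρ σ N)
rename-subst ρ σ (lam M)   = cong lam (trans (rename-subst (ext ρ) (exts σ) M)
  (subst-cong (λ { zero → refl
                 ; (suc x) → trans (rename-rename (ext ρ) suc (σ x)) (sym (rename-rename suc ρ (σ x))) }) M))

subst-subst : ∀ τ σ M → subst τ (subst σ M) ≡ subst (subst τ ∘ σ) M
subst-subst τ σ (var x)   = refl
subst-subst τ σ (app M N) = cong₂ app (subst-subst τ σ M) (subst-subst τ σ N)
subst-subst τ σ (lam M)   = cong lam (trans (subst-subst (exts τ) (exts σ) M)
  (subst-cong (λ { zero → refl
                 ; (suc x) → trans (subst-rename (exts τ) suc (σ x)) (sym (rename-subst suc τ (σ x))) }) M))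

subst-var : ∀ M → subst var M ≡ M
subst-var (var x)   = refl
subst-var (app M N) = cong₂ app (subst-var M) (subst-var N)
subst-var (lam M)   = cong lam (trans (subst-cong (λ { zero → refl ; (suc x) → refl }) M) (subst-var M))

infixr 5 _•_
_•_ : Tm → (ℕ → Tm) → ℕ → Tm
(N • σ) zero    = N
(N • σ) (suc x) = σ x

subst-exts-[] : ∀ σ N M → subst (exts σ) M [ N ] ≡ subst (N • σ) M
subst-exts-[] σ N M = trans (subst-subst (σ₀ N) (exts σ) M)
  (subst-cong (λ { zero → refl ; (suc x) → trans (subst-rename (σ₀ N) suc (σ x)) (subst-var (σ x)) }) M)

subst-[] : ∀ σ M N → subst σ (M [ N ]) ≡ subst (exts σ) M [ subst σ N ]
subst-[] σ M N = trans (subst-subst σ (σ₀ N) M) (trans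
  (subst-cong (λ { zero → refl ; (suc x) → refl }) M)
  (sym (subst-exts-[] σ (subst σ N) M)))

rename-[] : ∀ ρ M N → rename ρ (M [ N ]) ≡ rename (ext ρ) M [ rename ρ N ]
rename-[] ρ M N = trans (rename-subst ρ (σ₀ N) M) (trans
  (subst-cong (λ { zero → refl ; (suc x) → refl }) M)
  (sym (subst-rename (σ₀ (rename ρ N)) (ext ρ) M)))

infix 4 _↠_
_↠_ : Tm → Tm → Set
_↠_ = Star _→β_

rename-→β : ∀ ρ {M M′} → M →β M′ → rename ρ M →β rename ρ M′
rename-→β ρ (β {M} {N}) rewrite rename-[] ρ M N = β
rename-→β ρ (appˡ r) = appˡ (rename-→β ρ r)
rename-→β ρ (appʳ r) = appʳ (rename-→β ρ r)
rename-→β ρ (ξ r)    = ξ (rename-→β (ext ρ) r)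

subst-→β : ∀ σ {M M′} → M →β M′ → subst σ M →β subst σ M′
subst-→β σ (β {M} {N}) rewrite subst-[] σ M N = β
subst-→β σ (appˡ r) = appˡ (subst-→β σ r)
subst-→β σ (appʳ r) = appʳ (subst-→β σ r)
subst-→β σ (ξ r)    = ξ (subst-→β (exts σ) r)

subst-↠ : ∀ {σ τ} → (∀ x → σ x ↠ τ x) → ∀ M → subst σ M ↠ subst τ M
subst-↠ h (var x) = h x
subst-↠ {σ} {τ} h (app M N) =
  gmap (λ P → app P (subst σ N)) appˡ (subst-↠ h M) ◅◅ gmap (app (subst τ M)) appʳ (subst-↠ h N)
subst-↠ h (lam M) = gmap lam ξ (subst-↠ (λ { zero → ε ; (suc x) → gmap (rename suc) (rename-→β suc) (h x) }) M)

[]-↠ : ∀ M {N N′} → N →β N′ → M [ N ] ↠ M [ N′ ]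
[]-↠ M r = subst-↠ (λ { zero → r ◅ ε ; (suc x) → ε }) M

apps-snoc : ∀ h Ns N → apps h (Ns ++ N ∷ []) ≡ app (apps h Ns) N
apps-snoc h []       N = refl
apps-snoc h (M ∷ Ns) N = apps-snoc (app h M) Ns N

apps-→βʰ : ∀ {h h′} Ns → h →β h′ → apps h Ns →β apps h′ Ns
apps-→βʰ []       r = r
apps-→βʰ (N ∷ Ns) r = apps-→βʰ Ns (appˡ r)

infix 4 _→βᵃ_
data _→βᵃ_ : List Tm → List Tm → Set where
  step-head : ∀ {N N′ Ns} → N →β N′ → N ∷ Ns →βᵃ N′ ∷ Ns
  step-tail : ∀ {N Ns Ns′} → Ns →βᵃ Ns′ → N ∷ Ns →βᵃ N ∷ Ns′

apps-→βᵃ : ∀ h {Ns Ns′} → Ns →βᵃ Ns′ → apps h Ns →β apps h Ns′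
apps-→βᵃ h {N ∷ Ns} (step-head r) = apps-→βʰ Ns (appʳ r)
apps-→βᵃ h (step-tail {N} rs)      = apps-→βᵃ (app h N) rs

IsLam : Tm → Set
IsLam (lam _) = ⊤
IsLam _       = ⊥

data SpineStep (h : Tm) (Ns : List Tm) : Tm → Set where
  head : ∀ {h′}  → h →β h′    → SpineStep h Ns (apps h′ Ns)
  args : ∀ {Ns′} → Ns →βᵃ Ns′ → SpineStep h Ns (apps h Ns′)

apps-→β-inv : ∀ {h t} Ns → ¬ IsLam h → apps h Ns →β t → SpineStep h Ns t
apps-→β-inv []       _      r = head r
apps-→β-inv (N ∷ Ns) ¬lam-h r with apps-→β-inv Ns (λ ()) r
... | args rs        = args (step-tail rs)
... | head (appˡ r′) = head r′
... | head (appʳ r′) = args (step-head r′)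
... | head β         = ⊥-elim (¬lam-h tt)

-- Strong normalisation

SN-↠ : ∀ {M M′} → SN M → M ↠ M′ → SN M′
SN-↠ s ε        = s
SN-↠ s (r ◅ rs) = SN-↠ (acc-inverse s r) rs

SN-appˡ : ∀ {M N} → SN (app M N) → SN M
SN-appˡ (acc s) = acc λ r → SN-appˡ (s (appˡ r))

SN-appʳ : ∀ {M N} → SN (app M N) → SN N
SN-appʳ (acc s) = acc λ r → SN-appʳ (s (appʳ r))

SN-lam : ∀ {M} → SN M → SN (lam M)
SN-lam (acc s) = acc λ { (ξ r) → SN-lam (s r) }

SN-apps⁻ : ∀ h Ns → SN (apps h Ns) → SN h × All SN Ns
SN-apps⁻ h []       s = s , []
SN-apps⁻ h (N ∷ Ns) s with SN-apps⁻ (app h N) Ns s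
... | s-hN , s-Ns = SN-appˡ s-hN , SN-appʳ s-hN ∷ s-Ns

data Neutral : Tm → Set where
  ne-var : ∀ {x} → Neutral (var x)
  ne-app : ∀ {M N} → Neutral M → Neutral (app M N)

Neutral-→β : ∀ {M M′} → Neutral M → M →β M′ → Neutral M′
Neutral-→β (ne-app ne) (appˡ r) = ne-app (Neutral-→β ne r)
Neutral-→β (ne-app ne) (appʳ r) = ne-app ne
Neutral-→β (ne-app ()) β

SN-neutral-app : ∀ {M N} → Neutral M → SN M → SN N → SN (app M N)
SN-neutral-app ne (acc sM) (acc sN) = acc λ
  { β        → ⊥-elim (lam-non-neutral ne)
  ; (appˡ r) → SN-neutral-app (Neutral-→β ne r) (sM r) (acc sN)
  ; (appʳ r) → SN-neutral-app ne (acc sM) (sN r) }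
  where
  lam-non-neutral : ∀ {P} → ¬ Neutral (lam P)
  lam-non-neutral ()

SN-neutral-apps : ∀ {h} Ns → Neutral h → SN h → All SN Ns → SN (apps h Ns)
SN-neutral-apps []       ne s []           = s
SN-neutral-apps (N ∷ Ns) ne s (s-N ∷ s-Ns) = SN-neutral-apps Ns (ne-app ne) (SN-neutral-app ne s s-N) s-Ns

SN-var-apps : ∀ x Ns → All SN Ns → SN (apps (var x) Ns)
SN-var-apps x Ns = SN-neutral-apps Ns ne-var (acc λ ())

SN-expand : ∀ M N Ns → SN N → SN (apps (M [ N ]) Ns) → SN (apps (app (lam M) N) Ns)
SN-expand-step : ∀ {M N Ns t} → SN N → SN (apps (M [ N ]) Ns) → SpineStep (app (lam M) N) Ns t → SN t

SN-expand M N Ns s-N s-MN = acc λ r → SN-expand-step s-N s-MN (apps-→β-inv Ns (λ ()) r)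

SN-expand-step s-N s-MN (head β) = s-MN
SN-expand-step {N = N} {Ns} s-N (acc acc-MN) (head (appˡ (ξ {M' = M′} r))) =
  SN-expand M′ N Ns s-N (acc-MN (apps-→βʰ Ns (subst-→β (σ₀ N) r)))
SN-expand-step {M} {Ns = Ns} (acc acc-N) s-MN (head (appʳ {N' = N′} r)) =
  SN-expand M N′ Ns (acc-N r) (SN-↠ s-MN (gmap (λ P → apps P Ns) (apps-→βʰ Ns) ([]-↠ M r)))
SN-expand-step {M} {N} s-N (acc acc-MN) (args {Ns′} rs) =
  SN-expand M N Ns′ s-N (acc-MN (apps-→βᵃ (M [ N ]) rs))

-- Soundness: typable terms are strongly normalising

⊢s⇒SN : ∀ {r Γ M A} → Γ ⊢s⟨ r ⟩ M ∶ A → SN M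
⊢s⇒SN (Ax _) = acc λ ()
⊢s⇒SN (Beta {M = M} {N} {Ns} d e) = SN-expand M N Ns (⊢s⇒SN e) (⊢s⇒SN d)
⊢s⇒SN (L⇒ {x = x} {y} {N} {Ns} _ _ d e _) =
  SN-var-apps x (N ∷ Ns) (⊢s⇒SN d ∷ proj₂ (SN-apps⁻ (var y) Ns (⊢s⇒SN e)))
⊢s⇒SN (R⇒ d)   = SN-lam (⊢s⇒SN d)
⊢s⇒SN (L∩ d _) = ⊢s⇒SN d
⊢s⇒SN (R∩ d _) = ⊢s⇒SN d

Red : Ty → Tm → Set
Red (tv _)  M = SN M
Red (A ⇒ B) M = ∀ N → Red A N → Red B (app M N)
Red (A ∩ B) M = Red A M × Red B M

Red⇒SN : ∀ A {M} → Red A M → SN M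
Red-var-apps : ∀ A x Ns → All SN Ns → Red A (apps (var x) Ns)

Red⇒SN (tv _)  r       = r
Red⇒SN (A ⇒ B) r       = SN-appˡ (Red⇒SN B (r (var 0) (Red-var-apps A 0 [] [])))
Red⇒SN (A ∩ B) (r , _) = Red⇒SN A r

Red-var-apps (tv _)  x Ns s-Ns = SN-var-apps x Ns s-Ns
Red-var-apps (A ⇒ B) x Ns s-Ns N r-N = transport (Red B) (apps-snoc (var x) Ns N)
  (Red-var-apps B x (Ns ++ N ∷ []) (++⁺ s-Ns (Red⇒SN A r-N ∷ [])))
Red-var-apps (A ∩ B) x Ns s-Ns = Red-var-apps A x Ns s-Ns , Red-var-apps B x Ns s-Ns

Red-expand : ∀ A M N Ns → SN N → Red A (apps (M [ N ]) Ns) → Red A (apps (app (lam M) N) Ns)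
Red-expand (tv _)  M N Ns s-N r = SN-expand M N Ns s-N r
Red-expand (A ⇒ B) M N Ns s-N r P r-P = transport (Red B) (apps-snoc (app (lam M) N) Ns P)
  (Red-expand B M N (Ns ++ P ∷ []) s-N (transport (Red B) (sym (apps-snoc (M [ N ]) Ns P)) (r P r-P)))
Red-expand (A ∩ B) M N Ns s-N (r , r′) = Red-expand A M N Ns s-N r , Red-expand B M N Ns s-N r′

infix 4 _⊨_
_⊨_ : (ℕ → Tm) → Ctx → Set
σ ⊨ Γ = ∀ {x B} → (x , B) ∈ Γ → Red B (σ x)

⊨-extend : ∀ {σ Γ N A} → σ ⊨ Γ → Red A N → (N • σ) ⊨ (zero , A) ∷ shiftCtx Γ
⊨-extend σ⊨Γ r-N (here refl) = r-N
⊨-extend σ⊨Γ r-N (there m) with ∈-map⁻ _ m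
... | _ , m′ , refl = σ⊨Γ m′

fundamental : ∀ {Γ M A σ} → Γ ⊢ M ∶ A → σ ⊨ Γ → Red A (subst σ M)
fundamental (Ax {x = x} {A} Δ≈) σ⊨Γ = σ⊨Γ (proj₂ (Δ≈ (x , A)) (here refl))
fundamental {σ = σ} (⇒I {M = M} {A} {B} d) σ⊨Γ N r-N =
  Red-expand B (subst (exts σ) M) N [] (Red⇒SN A r-N)
    (transport (Red B) (sym (subst-exts-[] σ N M)) (fundamental d (⊨-extend σ⊨Γ r-N)))
fundamental (⇒E d e)  σ⊨Γ = fundamental d σ⊨Γ _ (fundamental e σ⊨Γ)
fundamental (∩I d e)  σ⊨Γ = fundamental d σ⊨Γ , fundamental e σ⊨Γ
fundamental (∩Eˡ d)   σ⊨Γ = proj₁ (fundamental d σ⊨Γ)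
fundamental (∩Eʳ d)   σ⊨Γ = proj₂ (fundamental d σ⊨Γ)

⊢⇒SN : ∀ {Γ M A} → Γ ⊢ M ∶ A → SN M
⊢⇒SN {M = M} {A} d =
  transport SN (subst-var M) (Red⇒SN A (fundamental d λ {x} {B} _ → Red-var-apps B x [] []))

-- Inductive characterisation of strong normalisation

data SNᵢ : Tm → Set where
  sn-var : ∀ {x Ns} → All SNᵢ Ns → SNᵢ (apps (var x) Ns)
  sn-lam : ∀ {M} → SNᵢ M → SNᵢ (lam M)
  sn-β   : ∀ {M N Ns} → SNᵢ (apps (M [ N ]) Ns) → SNᵢ N → SNᵢ (apps (app (lam M) N) Ns)

-- One-hole term contexts, stored inside out.
data Zipper : Set where
  ∙     : Zipper
  fun∙  : Zipper → Tm → Zipper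
  arg∙  : Tm → Zipper → Zipper
  body∙ : Zipper → Zipper

plug : Zipper → Tm → Tm
plug ∙          M = M
plug (fun∙ E N) M = plug E (app M N)
plug (arg∙ L E) M = plug E (app L M)
plug (body∙ E)  M = plug E (lam M)

plug-→β : ∀ E {M M′} → M →β M′ → plug E M →β plug E M′
plug-→β ∙          r = r
plug-→β (fun∙ E N) r = plug-→β E (appˡ r)
plug-→β (arg∙ L E) r = plug-→β E (appʳ r)
plug-→β (body∙ E)  r = plug-→β E (ξ r)

-- Recursion on M, and on the accessibility of plug E M where a redex is created.
SN-plug⇒SNᵢ : ∀ E M → SN (plug E M) → SNᵢ M
SNᵢ-app : ∀ E M N → SN (plug E (app M N)) → SNᵢ M → SNᵢ N → SNᵢ (app M N)

SN-plug⇒SNᵢ E (var x)   s = sn-var {x} {[]} []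
SN-plug⇒SNᵢ E (lam M)   s = sn-lam (SN-plug⇒SNᵢ (body∙ E) M s)
SN-plug⇒SNᵢ E (app M N) s = SNᵢ-app E M N s (SN-plug⇒SNᵢ (fun∙ E N) M s) (SN-plug⇒SNᵢ (arg∙ M E) N s)

SNᵢ-app E _ N s (sn-var {x} {Ns} sn-Ns) sn-N =
  transport SNᵢ (apps-snoc (var x) Ns N) (sn-var (++⁺ sn-Ns (sn-N ∷ [])))
SNᵢ-app E _ N (acc s) (sn-lam {P} _) sn-N =
  sn-β {Ns = []} (SN-plug⇒SNᵢ E (P [ N ]) (s (plug-→β E β))) sn-N
SNᵢ-app E _ N (acc s) (sn-β {P} {Q} {Ns} _ sn-Q) sn-N =
  transport SNᵢ (apps-snoc (app (lam P) Q) Ns N)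
    (sn-β {Ns = Ns ++ N ∷ []} (SN-plug⇒SNᵢ E (apps (P [ Q ]) (Ns ++ N ∷ [])) (s (plug-→β E contract))) sn-Q)
  where
  contract : app (apps (app (lam P) Q) Ns) N →β apps (P [ Q ]) (Ns ++ N ∷ [])
  contract = transport (_→β apps (P [ Q ]) (Ns ++ N ∷ [])) (apps-snoc (app (lam P) Q) Ns N)
    (apps-→βʰ (Ns ++ N ∷ []) β)

SN⇒SNᵢ : ∀ {M} → SN M → SNᵢ M
SN⇒SNᵢ {M} = SN-plug⇒SNᵢ ∙ M

-- Completeness for Λ∩ˢ without (R∩)

infix 4 _≤π_
data _≤π_ : Ty → Ty → Set where
  π-refl : ∀ {A} → A ≤π A
  π-l    : ∀ {A B C} → A ≤π C → A ∩ B ≤π C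
  π-r    : ∀ {A B C} → B ≤π C → A ∩ B ≤π C

infix 4 _⊑_
_⊑_ : Ctx → Ctx → Set
Γ ⊑ Δ = ∀ {x B} → (x , B) ∈ Γ → ∃[ B′ ] ((x , B′) ∈ Δ × B′ ≤π B)

⊑-refl : ∀ {Γ} → Γ ⊑ Γ
⊑-refl m = _ , m , π-refl

⊑-⊆ : ∀ {Γ Δ Δ′} → Γ ⊑ Δ → Δ ⊆ Δ′ → Γ ⊑ Δ′
⊑-⊆ Γ⊑Δ Δ⊆Δ′ m with Γ⊑Δ m
... | B′ , m′ , p = B′ , Δ⊆Δ′ m′ , p

∈⇒≈∷ : ∀ {p Δ} → p ∈ Δ → Δ ≈ (p ∷ Δ)
∈⇒≈∷ m q = there , λ { (here refl) → m ; (there m′) → m′ }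

L∩-project : ∀ {Δ x B C Ns D} → (x , B) ∈ Δ → B ≤π C →
  (∀ {Δ′} → (x , C) ∈ Δ′ → Δ ⊆ Δ′ → Δ′ ⊢s⟨ false ⟩ apps (var x) Ns ∶ D) →
  Δ ⊢s⟨ false ⟩ apps (var x) Ns ∶ D
L∩-project m π-refl k = k m (λ m′ → m′)
L∩-project {Δ} {Ns = Ns} m (π-l p) k =
  L∩ {Γ = Δ} {Ns = Ns} (L∩-project {Ns = Ns} (here refl) p (λ m′ s → k m′ (s ∘ there ∘ there))) (∈⇒≈∷ m)
L∩-project {Δ} {Ns = Ns} m (π-r p) k =
  L∩ {Γ = Δ} {Ns = Ns} (L∩-project {Ns = Ns} (there (here refl)) p (λ m′ s → k m′ (s ∘ there ∘ there))) (∈⇒≈∷ m)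

fvBound : Tm → ℕ
fvBound (var x)   = suc x
fvBound (app M N) = fvBound M ⊔ fvBound N
fvBound (lam M)   = pred (fvBound M)

∈FV⇒<fvBound : ∀ {x M} → x ∈FV M → x < fvBound M
∈FV⇒<fvBound fv-var = ≤-refl
∈FV⇒<fvBound {M = app M N} (fv-appˡ p) = <-≤-trans (∈FV⇒<fvBound p) (m≤m⊔n (fvBound M) (fvBound N))
∈FV⇒<fvBound {M = app M N} (fv-appʳ p) = <-≤-trans (∈FV⇒<fvBound p) (m≤n⊔m (fvBound M) (fvBound N))
∈FV⇒<fvBound (fv-lam p) = pred-mono-≤ (∈FV⇒<fvBound p)

fvsBound : List Tm → ℕ
fvsBound []       = 0
fvsBound (N ∷ Ns) = fvBound N ⊔ fvsBound Ns

ctxBound : Ctx → ℕ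
ctxBound []            = 0
ctxBound ((x , _) ∷ Γ) = suc x ⊔ ctxBound Γ

∈⇒<ctxBound : ∀ {x B Γ} → (x , B) ∈ Γ → x < ctxBound Γ
∈⇒<ctxBound {Γ = (y , _) ∷ Γ} (here refl) = m≤m⊔n (suc y) (ctxBound Γ)
∈⇒<ctxBound {Γ = (y , _) ∷ Γ} (there m)   = <-≤-trans (∈⇒<ctxBound m) (m≤n⊔m (suc y) (ctxBound Γ))

fvsBound≤⇒∉FVs : ∀ z Ns → fvsBound Ns ≤ z → z ∉FVs Ns
fvsBound≤⇒∉FVs z []       _ = tt
fvsBound≤⇒∉FVs z (N ∷ Ns) le =
  (λ p → <-irrefl refl (<-≤-trans (∈FV⇒<fvBound p) (≤-trans (m≤m⊔n (fvBound N) (fvsBound Ns)) le))) ,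
  fvsBound≤⇒∉FVs z Ns (≤-trans (m≤n⊔m (fvBound N) (fvsBound Ns)) le)

ctxBound≤⇒∉ : ∀ z Γ → ctxBound Γ ≤ z → z ∉ Γ
ctxBound≤⇒∉ z Γ le B m = <-irrefl refl (<-≤-trans (∈⇒<ctxBound m) le)

-- Derivations must survive refinement of the context: (L⇒) and (L∩) change it, and the
-- typings of different subterms are combined in one context.
record StableTyping (M : Tm) : Set where
  field
    ctx    : Ctx
    type   : Ty
    derive : ∀ {Δ} → ctx ⊑ Δ → Δ ⊢s⟨ false ⟩ M ∶ type
open StableTyping

types : ∀ {Ns} → All StableTyping Ns → List Ty
types []       = []
types (t ∷ ts) = type t ∷ types ts

ctxs : ∀ {Ns} → All StableTyping Ns → Ctx
ctxs []       = []
ctxs (t ∷ ts) = ctx t ++ ctxs ts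

arrows : List Ty → Ty → Ty
arrows []       B = B
arrows (A ∷ As) B = A ⇒ arrows As B

L⇒-spine : ∀ Ns (ts : All StableTyping Ns) B {Δ y} → ctxs ts ⊑ Δ → (y , arrows (types ts) B) ∈ Δ →
  Δ ⊢s⟨ false ⟩ apps (var y) Ns ∶ B
L⇒-spine []       []       B w m = Ax (∈⇒≈∷ m)
L⇒-spine (N ∷ Ns) (t ∷ ts) B {Δ} w m =
  L⇒ {Γ = Δ} {y = z} {Ns = Ns}
     (fvsBound≤⇒∉FVs z Ns (m≤n⊔m (ctxBound Δ) (fvsBound Ns)))
     (ctxBound≤⇒∉ z Δ (m≤m⊔n (ctxBound Δ) (fvsBound Ns)))
     (derive t (w ∘ ∈-++⁺ˡ))
     (L⇒-spine Ns ts B (⊑-⊆ (w ∘ ∈-++⁺ʳ (ctx t)) there) (here refl))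
     (∈⇒≈∷ m)
  where
  z : ℕ
  z = ctxBound Δ ⊔ fvsBound Ns

unshift : Ctx → Ctx
unshift []                = []
unshift ((zero , _) ∷ Γ)  = unshift Γ
unshift ((suc x , C) ∷ Γ) = (x , C) ∷ unshift Γ

unshift-∈ : ∀ {x C} Γ → (suc x , C) ∈ Γ → (x , C) ∈ unshift Γ
unshift-∈ ((zero , _) ∷ Γ)  (there m)   = unshift-∈ Γ m
unshift-∈ ((suc _ , _) ∷ Γ) (here refl) = here refl
unshift-∈ ((suc _ , _) ∷ Γ) (there m)   = there (unshift-∈ Γ m)

-- tv 0 is an arbitrary type for the case that Γ does not mention index 0.
meet₀ : Ctx → Ty
meet₀ []                = tv 0
meet₀ ((zero , C) ∷ Γ)  = C ∩ meet₀ Γ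
meet₀ ((suc _ , _) ∷ Γ) = meet₀ Γ

meet₀-≤π : ∀ {C} Γ → (zero , C) ∈ Γ → meet₀ Γ ≤π C
meet₀-≤π ((zero , _) ∷ Γ)  (here refl) = π-l π-refl
meet₀-≤π ((zero , _) ∷ Γ)  (there m)   = π-r (meet₀-≤π Γ m)
meet₀-≤π ((suc _ , _) ∷ Γ) (there m)   = meet₀-≤π Γ m

⊑-under-binder : ∀ {Γ Δ} → unshift Γ ⊑ Δ → Γ ⊑ (zero , meet₀ Γ) ∷ shiftCtx Δ
⊑-under-binder {Γ} w {zero}  m = meet₀ Γ , here refl , meet₀-≤π Γ m
⊑-under-binder {Γ} w {suc x} m with w (unshift-∈ Γ m)
... | B′ , m′ , p = B′ , there (∈-map⁺ _ m′) , p

SNᵢ⇒StableTyping : ∀ {M} → SNᵢ M → StableTyping M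
All-SNᵢ⇒StableTyping : ∀ {Ns} → All SNᵢ Ns → All StableTyping Ns

All-SNᵢ⇒StableTyping []             = []
All-SNᵢ⇒StableTyping (sn-M ∷ sn-Ns) = SNᵢ⇒StableTyping sn-M ∷ All-SNᵢ⇒StableTyping sn-Ns

SNᵢ⇒StableTyping (sn-var {x} {Ns} sn-Ns) = record
  { ctx    = (x , arrows (types ts) (tv 0)) ∷ ctxs ts
  ; type   = tv 0
  ; derive = λ w → let (_ , m , p) = w (here refl) in
      L∩-project {Ns = Ns} m p (λ m′ s → L⇒-spine Ns ts (tv 0) (⊑-⊆ (w ∘ there) s) m′)
  }
  where
  ts : All StableTyping Ns
  ts = All-SNᵢ⇒StableTyping sn-Ns
SNᵢ⇒StableTyping (sn-lam {M} sn-M) = record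
  { ctx    = unshift (ctx t)
  ; type   = meet₀ (ctx t) ⇒ type t
  ; derive = λ w → R⇒ (derive t (⊑-under-binder w))
  }
  where
  t : StableTyping M
  t = SNᵢ⇒StableTyping sn-M
SNᵢ⇒StableTyping (sn-β {M} {N} {Ns} sn-MN sn-N) = record
  { ctx    = ctx t ++ ctx u
  ; type   = type t
  ; derive = λ w → Beta {M = M} {N} {Ns} (derive t (w ∘ ∈-++⁺ˡ)) (derive u (w ∘ ∈-++⁺ʳ (ctx t)))
  }
  where
  t : StableTyping (apps (M [ N ]) Ns)
  t = SNᵢ⇒StableTyping sn-MN
  u : StableTyping N
  u = SNᵢ⇒StableTyping sn-N

SNᵢ⇒Typableˢ-noR∩ : ∀ {M} → SNᵢ M → Typableˢ-noR∩ M
SNᵢ⇒Typableˢ-noR∩ {M} sn-M = ctx t , type t , derive t ⊑-refl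
  where
  t : StableTyping M
  t = SNᵢ⇒StableTyping sn-M

-- Completeness for Λ∩

infix 4 _≼_
data _≼_ : Ty → Ty → Set where
  ≼-refl : ∀ {A} → A ≼ A
  ≼-l    : ∀ {A B C} → A ≼ C → A ∩ B ≼ C
  ≼-r    : ∀ {A B C} → B ≼ C → A ∩ B ≼ C
  ≼-∩    : ∀ {A B C} → A ≼ B → A ≼ C → A ≼ B ∩ C

≼-trans : ∀ {A B C} → A ≼ B → B ≼ C → A ≼ C
≼-trans ≼-refl      q            = q
≼-trans (≼-l p)     q            = ≼-l (≼-trans p q)
≼-trans (≼-r p)     q            = ≼-r (≼-trans p q)
≼-trans (≼-∩ p₁ p₂) ≼-refl       = ≼-∩ p₁ p₂
≼-trans (≼-∩ p₁ p₂) (≼-l q)      = ≼-trans p₁ q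
≼-trans (≼-∩ p₁ p₂) (≼-r q)      = ≼-trans p₂ q
≼-trans (≼-∩ p₁ p₂) (≼-∩ q₁ q₂) = ≼-∩ (≼-trans (≼-∩ p₁ p₂) q₁) (≼-trans (≼-∩ p₁ p₂) q₂)

-- A context with one optional type per de Bruijn index, so distinctness holds by construction.
DCtx : Set
DCtx = List (Maybe Ty)

look : DCtx → ℕ → Maybe Ty
look []      _       = nothing
look (m ∷ Γ) zero    = m
look (m ∷ Γ) (suc x) = look Γ x

infix 3 _⊢ᵈ_∶_
data _⊢ᵈ_∶_ (Γ : DCtx) : Tm → Ty → Set where
  dvar : ∀ {x A B} → look Γ x ≡ just B → B ≼ A → Γ ⊢ᵈ var x ∶ A
  dlam : ∀ {M A B} → just A ∷ Γ ⊢ᵈ M ∶ B → Γ ⊢ᵈ lam M ∶ A ⇒ B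
  dapp : ∀ {M N A B} → Γ ⊢ᵈ M ∶ A ⇒ B → Γ ⊢ᵈ N ∶ A → Γ ⊢ᵈ app M N ∶ B
  d∩   : ∀ {M A B} → Γ ⊢ᵈ M ∶ A → Γ ⊢ᵈ M ∶ B → Γ ⊢ᵈ M ∶ A ∩ B

infix 4 _⊑ᵈ_
_⊑ᵈ_ : DCtx → DCtx → Set
Γ ⊑ᵈ Γ′ = ∀ x {B} → look Γ x ≡ just B → ∃[ E ] (look Γ′ x ≡ just E × E ≼ B)

⊑ᵈ-trans : ∀ {Γ₁ Γ₂ Γ₃} → Γ₁ ⊑ᵈ Γ₂ → Γ₂ ⊑ᵈ Γ₃ → Γ₁ ⊑ᵈ Γ₃
⊑ᵈ-trans w v x e with w x e
... | _ , e′ , p with v x e′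
... | E , e″ , q = E , e″ , ≼-trans q p

⊢ᵈ-weaken : ∀ {Γ Γ′ M A} → Γ ⊑ᵈ Γ′ → Γ ⊢ᵈ M ∶ A → Γ′ ⊢ᵈ M ∶ A
⊢ᵈ-weaken w (dvar {x} e p) with w x e
... | _ , e′ , q = dvar e′ (≼-trans q p)
⊢ᵈ-weaken {Γ} {Γ′} w (dlam {A = A} d) = dlam (⊢ᵈ-weaken w′ d)
  where
  w′ : just A ∷ Γ ⊑ᵈ just A ∷ Γ′
  w′ zero    refl = A , refl , ≼-refl
  w′ (suc x) e    = w x e
⊢ᵈ-weaken w (dapp d e) = dapp (⊢ᵈ-weaken w d) (⊢ᵈ-weaken w e)
⊢ᵈ-weaken w (d∩ d e)   = d∩ (⊢ᵈ-weaken w d) (⊢ᵈ-weaken w e)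

⊢ᵈ-rename⁻ : ∀ {Γ Γ′ ρ} M {C} → (∀ x → look Γ′ x ≡ look Γ (ρ x)) → Γ ⊢ᵈ rename ρ M ∶ C → Γ′ ⊢ᵈ M ∶ C
⊢ᵈ-rename⁻ (var x)   h (dvar e p) = dvar (trans (h x) e) p
⊢ᵈ-rename⁻ (app M N) h (dapp d e) = dapp (⊢ᵈ-rename⁻ M h d) (⊢ᵈ-rename⁻ N h e)
⊢ᵈ-rename⁻ (lam M)   h (dlam d)   = dlam (⊢ᵈ-rename⁻ M (λ { zero → refl ; (suc x) → h x }) d)
⊢ᵈ-rename⁻ (var x)   h (d∩ d e)   = d∩ (⊢ᵈ-rename⁻ (var x) h d) (⊢ᵈ-rename⁻ (var x) h e)
⊢ᵈ-rename⁻ (app M N) h (d∩ d e)   = d∩ (⊢ᵈ-rename⁻ (app M N) h d) (⊢ᵈ-rename⁻ (app M N) h e)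
⊢ᵈ-rename⁻ (lam M)   h (d∩ d e)   = d∩ (⊢ᵈ-rename⁻ (lam M) h d) (⊢ᵈ-rename⁻ (lam M) h e)

infixl 6 _∩ᵐ_ _⊔ᵈ_
_∩ᵐ_ : Maybe Ty → Maybe Ty → Maybe Ty
nothing ∩ᵐ n       = n
just A  ∩ᵐ nothing = just A
just A  ∩ᵐ just B  = just (A ∩ B)

_⊔ᵈ_ : DCtx → DCtx → DCtx
[]      ⊔ᵈ Δ       = Δ
(m ∷ Γ) ⊔ᵈ []      = m ∷ Γ
(m ∷ Γ) ⊔ᵈ (n ∷ Δ) = m ∩ᵐ n ∷ Γ ⊔ᵈ Δ

look-⊔ᵈ : ∀ Γ Δ x → look (Γ ⊔ᵈ Δ) x ≡ look Γ x ∩ᵐ look Δ x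
look-⊔ᵈ []      Δ       x       = refl
look-⊔ᵈ (m ∷ Γ) []      x       = sym (∩ᵐ-nothing (look (m ∷ Γ) x))
  where
  ∩ᵐ-nothing : ∀ m → m ∩ᵐ nothing ≡ m
  ∩ᵐ-nothing nothing  = refl
  ∩ᵐ-nothing (just _) = refl
look-⊔ᵈ (m ∷ Γ) (n ∷ Δ) zero    = refl
look-⊔ᵈ (m ∷ Γ) (n ∷ Δ) (suc x) = look-⊔ᵈ Γ Δ x

⊑ᵈ-⊔ᵈˡ : ∀ Γ Δ → Γ ⊑ᵈ Γ ⊔ᵈ Δ
⊑ᵈ-⊔ᵈˡ Γ Δ x {B} e rewrite look-⊔ᵈ Γ Δ x | e with look Δ x
... | nothing = B , refl , ≼-refl
... | just C  = B ∩ C , refl , ≼-l ≼-refl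

⊑ᵈ-⊔ᵈʳ : ∀ Γ Δ → Δ ⊑ᵈ Γ ⊔ᵈ Δ
⊑ᵈ-⊔ᵈʳ Γ Δ x {B} e rewrite look-⊔ᵈ Γ Δ x | e with look Γ x
... | nothing = B , refl , ≼-refl
... | just C  = C ∩ B , refl , ≼-r ≼-refl

singleton : ℕ → Ty → DCtx
singleton zero    A = just A ∷ []
singleton (suc x) A = nothing ∷ singleton x A

look-singleton : ∀ x A → look (singleton x A) x ≡ just A
look-singleton zero    A = refl
look-singleton (suc x) A = look-singleton x A

look-singleton⁻ : ∀ x A y C → look (singleton x A) y ≡ just C → y ≡ x × C ≡ A
look-singleton⁻ zero    A zero    C refl = refl , refl
look-singleton⁻ (suc x) A (suc y) C e with look-singleton⁻ x A y C e
... | refl , refl = refl , refl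

just-injective : ∀ {A B : Ty} → just A ≡ just B → A ≡ B
just-injective refl = refl

⊢ᵈ-var⁻ : ∀ {Γ x C} → Γ ⊢ᵈ var x ∶ C → ∃[ E ] (look Γ x ≡ just E × E ≼ C)
⊢ᵈ-var⁻ (dvar e p) = _ , e , p
⊢ᵈ-var⁻ (d∩ d₁ d₂) with ⊢ᵈ-var⁻ d₁ | ⊢ᵈ-var⁻ d₂
... | E , e₁ , p₁ | _ , e₂ , p₂ with just-injective (trans (sym e₁) e₂)
... | refl = E , e₁ , ≼-∩ p₁ p₂

tail : DCtx → DCtx
tail []      = []
tail (_ ∷ Γ) = Γ

look-tail : ∀ Γ x → look (tail Γ) x ≡ look Γ (suc x)
look-tail []      x = refl
look-tail (_ ∷ Γ) x = refl

⊑ᵈ-replace-head : ∀ Γ A → (∀ {C} → look Γ zero ≡ just C → A ≼ C) → Γ ⊑ᵈ just A ∷ tail Γ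
⊑ᵈ-replace-head Γ A h zero        e = A , refl , h e
⊑ᵈ-replace-head Γ A h (suc x) {C} e = C , trans (look-tail Γ x) e , ≼-refl

headTy : DCtx → Ty
headTy (just A ∷ _) = A
headTy _            = tv 0

⊑ᵈ-head : ∀ Γ → Γ ⊑ᵈ just (headTy Γ) ∷ tail Γ
⊑ᵈ-head (just A ∷ Γ) zero    refl = A , refl , ≼-refl
⊑ᵈ-head (_ ∷ Γ)      (suc x) e    = _ , e , ≼-refl

infix 4 _⊢ᵈ_∶ˢ_
_⊢ᵈ_∶ˢ_ : DCtx → (ℕ → Tm) → DCtx → Set
Γ ⊢ᵈ σ ∶ˢ Δ = ∀ {x C} → look Δ x ≡ just C → Γ ⊢ᵈ σ x ∶ C

∶ˢ-⊔ᵈ : ∀ {Γ σ} Δ₁ Δ₂ → Γ ⊢ᵈ σ ∶ˢ Δ₁ → Γ ⊢ᵈ σ ∶ˢ Δ₂ → Γ ⊢ᵈ σ ∶ˢ Δ₁ ⊔ᵈ Δ₂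
∶ˢ-⊔ᵈ Δ₁ Δ₂ σ₁ σ₂ {x} e rewrite look-⊔ᵈ Δ₁ Δ₂ x with look Δ₁ x in e₁ | look Δ₂ x in e₂
∶ˢ-⊔ᵈ Δ₁ Δ₂ σ₁ σ₂ refl | nothing | just _ = σ₂ e₂
∶ˢ-⊔ᵈ Δ₁ Δ₂ σ₁ σ₂ refl | just _  | nothing = σ₁ e₁
∶ˢ-⊔ᵈ Δ₁ Δ₂ σ₁ σ₂ refl | just _  | just _  = d∩ (σ₁ e₁) (σ₂ e₂)

SubstInversion : DCtx → (ℕ → Tm) → Tm → Ty → Set
SubstInversion Γ σ M A = ∃[ Δ ] (Δ ⊢ᵈ M ∶ A × Γ ⊢ᵈ σ ∶ˢ Δ)

SubstInversion-∩ : ∀ {Γ σ M A B} → SubstInversion Γ σ M A → SubstInversion Γ σ M B → SubstInversion Γ σ M (A ∩ B)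
SubstInversion-∩ (Δ₁ , d₁ , σ₁) (Δ₂ , d₂ , σ₂) =
  Δ₁ ⊔ᵈ Δ₂ , d∩ (⊢ᵈ-weaken (⊑ᵈ-⊔ᵈˡ Δ₁ Δ₂) d₁) (⊢ᵈ-weaken (⊑ᵈ-⊔ᵈʳ Δ₁ Δ₂) d₂) , ∶ˢ-⊔ᵈ Δ₁ Δ₂ σ₁ σ₂

⊢ᵈ-subst⁻ : ∀ {Γ} σ M {A} → Γ ⊢ᵈ subst σ M ∶ A → SubstInversion Γ σ M A
⊢ᵈ-subst⁻ {Γ} σ (var x) {A} d = singleton x A , dvar (look-singleton x A) ≼-refl , σ-typed
  where
  σ-typed : Γ ⊢ᵈ σ ∶ˢ singleton x A
  σ-typed {y} {C} e with look-singleton⁻ x A y C e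
  ... | refl , refl = d
⊢ᵈ-subst⁻ σ (app M N) (dapp d e) with ⊢ᵈ-subst⁻ σ M d | ⊢ᵈ-subst⁻ σ N e
... | Δ₁ , d₁ , σ₁ | Δ₂ , d₂ , σ₂ =
  Δ₁ ⊔ᵈ Δ₂ , dapp (⊢ᵈ-weaken (⊑ᵈ-⊔ᵈˡ Δ₁ Δ₂) d₁) (⊢ᵈ-weaken (⊑ᵈ-⊔ᵈʳ Δ₁ Δ₂) d₂) , ∶ˢ-⊔ᵈ Δ₁ Δ₂ σ₁ σ₂
⊢ᵈ-subst⁻ {Γ} σ (lam M) (dlam {A = A} d) with ⊢ᵈ-subst⁻ (exts σ) M d
... | Δ , d′ , σ-typed = tail Δ , dlam (⊢ᵈ-weaken (⊑ᵈ-replace-head Δ A head-≼) d′) , tail-typed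
  where
  head-≼ : ∀ {C} → look Δ zero ≡ just C → A ≼ C
  head-≼ e with ⊢ᵈ-var⁻ (σ-typed e)
  ... | _ , refl , p = p
  tail-typed : Γ ⊢ᵈ σ ∶ˢ tail Δ
  tail-typed {x} e = ⊢ᵈ-rename⁻ (σ x) (λ _ → refl) (σ-typed (trans (sym (look-tail Δ x)) e))
⊢ᵈ-subst⁻ σ (app M N) (d∩ d e) = SubstInversion-∩ (⊢ᵈ-subst⁻ σ (app M N) d) (⊢ᵈ-subst⁻ σ (app M N) e)
⊢ᵈ-subst⁻ σ (lam M)   (d∩ d e) = SubstInversion-∩ (⊢ᵈ-subst⁻ σ (lam M) d) (⊢ᵈ-subst⁻ σ (lam M) e)

-- The inversion types N once for each occurrence of the bound variable in M; if there is
-- none, the separately given type B of N is used.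
⊢ᵈ-β-expand : ∀ {Γ M N A B} → Γ ⊢ᵈ M [ N ] ∶ A → Γ ⊢ᵈ N ∶ B → Γ ⊢ᵈ app (lam M) N ∶ A
⊢ᵈ-β-expand {Γ} {M} {N} {B = B} d d-N with ⊢ᵈ-subst⁻ (σ₀ N) M d
... | Δ , d-M , σ-typed with look Δ zero in e₀
... | nothing = dapp (dlam (⊢ᵈ-weaken Δ⊑ d-M)) d-N
  where
  Δ⊑ : Δ ⊑ᵈ just B ∷ Γ
  Δ⊑ zero    e with () ← trans (sym e₀) e
  Δ⊑ (suc x) e = ⊢ᵈ-var⁻ (σ-typed e)
... | just C = dapp (dlam (⊢ᵈ-weaken Δ⊑ d-M)) (σ-typed e₀)
  where
  Δ⊑ : Δ ⊑ᵈ just C ∷ Γ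
  Δ⊑ zero    e with refl ← just-injective (trans (sym e₀) e) = C , refl , ≼-refl
  Δ⊑ (suc x) e = ⊢ᵈ-var⁻ (σ-typed e)

⊢ᵈ-apps-head : ∀ {Γ h h′} → (∀ {A} → Γ ⊢ᵈ h ∶ A → Γ ⊢ᵈ h′ ∶ A) →
  ∀ Ns {A} → Γ ⊢ᵈ apps h Ns ∶ A → Γ ⊢ᵈ apps h′ Ns ∶ A
⊢ᵈ-apps-head k []       d = k d
⊢ᵈ-apps-head {Γ} {h} {h′} k (N ∷ Ns) d = ⊢ᵈ-apps-head k-app Ns d
  where
  k-app : ∀ {A} → Γ ⊢ᵈ app h N ∶ A → Γ ⊢ᵈ app h′ N ∶ A
  k-app (dapp d₁ d₂) = dapp (k d₁) d₂
  k-app (d∩ d₁ d₂)   = d∩ (k-app d₁) (k-app d₂)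

Typableᵈ : Tm → Set
Typableᵈ M = ∃[ Γ ] ∃[ A ] (Γ ⊢ᵈ M ∶ A)

typesᵈ : ∀ {Ns} → All Typableᵈ Ns → List Ty
typesᵈ []                = []
typesᵈ ((_ , A , _) ∷ ts) = A ∷ typesᵈ ts

ctxsᵈ : ∀ {Ns} → All Typableᵈ Ns → DCtx
ctxsᵈ []                = []
ctxsᵈ ((Γ , _ , _) ∷ ts) = Γ ⊔ᵈ ctxsᵈ ts

⊢ᵈ-apps : ∀ {Γ h B} Ns (ts : All Typableᵈ Ns) → Γ ⊢ᵈ h ∶ arrows (typesᵈ ts) B → ctxsᵈ ts ⊑ᵈ Γ →
  Γ ⊢ᵈ apps h Ns ∶ B
⊢ᵈ-apps []       []                  d w = d
⊢ᵈ-apps {Γ} (N ∷ Ns) ((Γ₁ , A , d₁) ∷ ts) d w =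
  ⊢ᵈ-apps Ns ts (dapp d (⊢ᵈ-weaken (⊑ᵈ-trans {Γ₁} {Γ₁ ⊔ᵈ ctxsᵈ ts} {Γ} (⊑ᵈ-⊔ᵈˡ Γ₁ (ctxsᵈ ts)) w) d₁))
    (⊑ᵈ-trans {ctxsᵈ ts} {Γ₁ ⊔ᵈ ctxsᵈ ts} {Γ} (⊑ᵈ-⊔ᵈʳ Γ₁ (ctxsᵈ ts)) w)

SNᵢ⇒Typableᵈ : ∀ {M} → SNᵢ M → Typableᵈ M
All-SNᵢ⇒Typableᵈ : ∀ {Ns} → All SNᵢ Ns → All Typableᵈ Ns

All-SNᵢ⇒Typableᵈ []             = []
All-SNᵢ⇒Typableᵈ (sn-M ∷ sn-Ns) = SNᵢ⇒Typableᵈ sn-M ∷ All-SNᵢ⇒Typableᵈ sn-Ns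

SNᵢ⇒Typableᵈ (sn-var {x} {Ns} sn-Ns) =
  Γ-x ⊔ᵈ ctxsᵈ ts , tv 0 , ⊢ᵈ-apps Ns ts x-typed (⊑ᵈ-⊔ᵈʳ Γ-x (ctxsᵈ ts))
  where
  ts : All Typableᵈ Ns
  ts = All-SNᵢ⇒Typableᵈ sn-Ns
  Γ-x : DCtx
  Γ-x = singleton x (arrows (typesᵈ ts) (tv 0))
  x-typed : Γ-x ⊔ᵈ ctxsᵈ ts ⊢ᵈ var x ∶ arrows (typesᵈ ts) (tv 0)
  x-typed = ⊢ᵈ-weaken {Γ-x} (⊑ᵈ-⊔ᵈˡ Γ-x (ctxsᵈ ts)) (dvar (look-singleton x _) ≼-refl)
SNᵢ⇒Typableᵈ (sn-lam sn-M) with SNᵢ⇒Typableᵈ sn-M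
... | Γ , B , d = tail Γ , headTy Γ ⇒ B , dlam (⊢ᵈ-weaken (⊑ᵈ-head Γ) d)
SNᵢ⇒Typableᵈ (sn-β {Ns = Ns} sn-MN sn-N) with SNᵢ⇒Typableᵈ sn-MN | SNᵢ⇒Typableᵈ sn-N
... | Γ₁ , A , d₁ | Γ₂ , _ , d₂ =
  Γ₁ ⊔ᵈ Γ₂ , A ,
  ⊢ᵈ-apps-head (λ d → ⊢ᵈ-β-expand d (⊢ᵈ-weaken (⊑ᵈ-⊔ᵈʳ Γ₁ Γ₂) d₂)) Ns (⊢ᵈ-weaken (⊑ᵈ-⊔ᵈˡ Γ₁ Γ₂) d₁)

toCtx : DCtx → Ctx
toCtx []            = []
toCtx (nothing ∷ Γ) = shiftCtx (toCtx Γ)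
toCtx (just A ∷ Γ)  = (zero , A) ∷ shiftCtx (toCtx Γ)

∈-shiftCtx⁻ : ∀ {x A Γ} → (x , A) ∈ shiftCtx Γ → ∃[ z ] (x ≡ suc z × (z , A) ∈ Γ)
∈-shiftCtx⁻ m with ∈-map⁻ _ m
... | (z , _) , m′ , refl = z , refl , m′

∈-toCtx⇒look : ∀ Γ {x A} → (x , A) ∈ toCtx Γ → look Γ x ≡ just A
∈-toCtx⇒look (nothing ∷ Γ) m with ∈-shiftCtx⁻ m
... | _ , refl , m′ = ∈-toCtx⇒look Γ m′
∈-toCtx⇒look (just _ ∷ Γ) (here refl) = refl
∈-toCtx⇒look (just _ ∷ Γ) (there m) with ∈-shiftCtx⁻ m
... | _ , refl , m′ = ∈-toCtx⇒look Γ m′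

look⇒∈-toCtx : ∀ Γ x {A} → look Γ x ≡ just A → (x , A) ∈ toCtx Γ
look⇒∈-toCtx (just _ ∷ Γ)  zero    refl = here refl
look⇒∈-toCtx (nothing ∷ Γ) (suc x) e    = ∈-map⁺ _ (look⇒∈-toCtx Γ x e)
look⇒∈-toCtx (just _ ∷ Γ)  (suc x) e    = there (∈-map⁺ _ (look⇒∈-toCtx Γ x e))

toCtx-Distinct : ∀ Γ → Distinct (toCtx Γ)
toCtx-Distinct Γ x A B m₁ m₂ = just-injective (trans (sym (∈-toCtx⇒look Γ m₁)) (∈-toCtx⇒look Γ m₂))

⊢-≼ : ∀ {Δ M A B} → Δ ⊢ M ∶ B → B ≼ A → Δ ⊢ M ∶ A
⊢-≼ d ≼-refl    = d
⊢-≼ d (≼-l p)   = ⊢-≼ (∩Eˡ d) p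
⊢-≼ d (≼-r p)   = ⊢-≼ (∩Eʳ d) p
⊢-≼ d (≼-∩ p q) = ∩I (⊢-≼ d p) (⊢-≼ d q)

⊢ᵈ⇒⊢ : ∀ {Γ M A} → Γ ⊢ᵈ M ∶ A → toCtx Γ ⊢ M ∶ A
⊢ᵈ⇒⊢ {Γ} (dvar {x} e p) = ⊢-≼ (Ax (∈⇒≈∷ (look⇒∈-toCtx Γ x e))) p
⊢ᵈ⇒⊢ (dlam d)           = ⇒I (⊢ᵈ⇒⊢ d)
⊢ᵈ⇒⊢ (dapp d e)         = ⇒E (⊢ᵈ⇒⊢ d) (⊢ᵈ⇒⊢ e)
⊢ᵈ⇒⊢ (d∩ d e)           = ∩I (⊢ᵈ⇒⊢ d) (⊢ᵈ⇒⊢ e)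

SNᵢ⇒Typable∩ : ∀ {M} → SNᵢ M → Typable∩ M
SNᵢ⇒Typable∩ sn-M with SNᵢ⇒Typableᵈ sn-M
... | Γ , A , d = toCtx Γ , A , toCtx-Distinct Γ , ⊢ᵈ⇒⊢ d

⊢s-noR∩⇒⊢s : ∀ {Γ M A} → Γ ⊢s⟨ false ⟩ M ∶ A → Γ ⊢s⟨ true ⟩ M ∶ A
⊢s-noR∩⇒⊢s (Ax Δ≈)                     = Ax Δ≈
⊢s-noR∩⇒⊢s (Beta {M = M} {N} {Ns} d e) = Beta {M = M} {N} {Ns} (⊢s-noR∩⇒⊢s d) (⊢s-noR∩⇒⊢s e)
⊢s-noR∩⇒⊢s (L⇒ {Ns = Ns} y∉Ns y∉Γ d e Δ≈) =
  L⇒ {Ns = Ns} y∉Ns y∉Γ (⊢s-noR∩⇒⊢s d) (⊢s-noR∩⇒⊢s e) Δ≈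
⊢s-noR∩⇒⊢s (R⇒ d)                     = R⇒ (⊢s-noR∩⇒⊢s d)
⊢s-noR∩⇒⊢s (L∩ {Ns = Ns} d Δ≈)        = L∩ {Ns = Ns} (⊢s-noR∩⇒⊢s d) Δ≈

Typable∩⇒SN : ∀ {M} → Typable∩ M → SN M
Typable∩⇒SN (_ , _ , _ , d) = ⊢⇒SN d

Typableˢ⇒SN : ∀ {M} → Typableˢ M → SN M
Typableˢ⇒SN (_ , _ , d) = ⊢s⇒SN d

Typableˢ-noR∩⇒SN : ∀ {M} → Typableˢ-noR∩ M → SN M
Typableˢ-noR∩⇒SN (_ , _ , d) = ⊢s⇒SN d

Typableˢ-noR∩⇒Typableˢ : ∀ {M} → Typableˢ-noR∩ M → Typableˢ M
Typableˢ-noR∩⇒Typableˢ (Γ , A , d) = Γ , A , ⊢s-noR∩⇒⊢s d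

SN⇒Typable∩ : ∀ {M} → SN M → Typable∩ M
SN⇒Typable∩ = SNᵢ⇒Typable∩ ∘ SN⇒SNᵢ

SN⇒Typableˢ-noR∩ : ∀ {M} → SN M → Typableˢ-noR∩ M
SN⇒Typableˢ-noR∩ = SNᵢ⇒Typableˢ-noR∩ ∘ SN⇒SNᵢ

corollary1 : ∀ (M : Tm) →
    (Typable∩ M ⇔ Typableˢ M) × (Typable∩ M ⇔ SN M) × (Typable∩ M ⇔ Typableˢ-noR∩ M)
corollary1 M =
  mk⇔ (Typableˢ-noR∩⇒Typableˢ ∘ SN⇒Typableˢ-noR∩ ∘ Typable∩⇒SN) (SN⇒Typable∩ ∘ Typableˢ⇒SN) ,
  mk⇔ Typable∩⇒SN SN⇒Typable∩ ,
  mk⇔ (SN⇒Typableˢ-noR∩ ∘ Typable∩⇒SN) (SN⇒Typable∩ ∘ Typableˢ-noR∩⇒SN)
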